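{- Let $G$ be a finite simple graph containing no induced chordless cycle on 4 vertices and in which $|F_e|\le 3$ for every edge $e$. Let $u,v,w$ be an induced path on 3 vertices in $G$, and define $A,B,C,D$, $B_i$, $E_i$ and $j$ as in the context. If $j\ge 2$ (possibly $j=\infty$), then for every $x\in B_i$ with $2\le i\le j$ we have $|N_{\mathrm{same}}(x)|\le 1$; moreover, if $|N_{\mathrm{same}}(x)|=1$ then $N_{\mathrm{next}}(x)=\emptyset$.
   Context: For an edge $e$ of $G$, $F_e$ is the set of all edges $e'$ of $G$ such that $V(e)\cup V(e')$ induces a path on 3 vertices in $G$. Let $u,v,w$ be an induced path on 3 vertices ($uv,vw\in E(G)$, $uw\notin E(G)$) and $A=\{u,v,w\}$. Let $B$ be the set of vertices not in $A$ having exactly one or two neighbors in $A$; $C$ the set of vertices having three neighbors in $A$; $D$ the set of vertices not in $A\cup B\cup C$ having at least one neighbor in $C$. For $i\ge 1$, $B_i$ is the set of vertices $x\notin A\cup B\cup C\cup D$ whose minimum distance in $G$ to a vertex of $B$ is exactly $i$; also $B_0=B$ and $B_{ -1}=A$. For $x\in B_i$ ($i\ge 0$), $N_{\mathrm{next}}(x)$, $N_{\mathrm{same}}(x)$, $N_{\mathrm{prev}}(x)$ denote the sets of neighbors of $x$ in $B_{i+1}$, $B_i$, $B_{i-1}$ respectively. For $i\ge 0$, $E_i$ is the set of edges with one endpoint in $B_i$ and the other in $B_{i+1}$. $j$ is the minimum index $i\ge 0$ such that some edge $e\in E_i$ has $|F_e|\ge 3$; if no such index exists, $j=\infty$. -}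

module Defs where

open import Data.Nat using (ℕ; zero; suc; _+_; _≤_; _<_; _≡ᵇ_; _<ᵇ_)
open import Data.Bool using (Bool; true; false; _∧_; _∨_; not; if_then_else_)
open import Data.Fin using (Fin; toℕ) renaming (zero to fzero; suc to fsuc)
open import Data.Fin.Properties using (_≟_)
open import Relation.Nullary.Decidable using (⌊_⌋)
open import Relation.Binary.PropositionalEquality using (_≡_)
open import Relation.Nullary using (¬_)
open import Data.Empty using (⊥)

record Graph : Set where
  field
    n      : ℕ
    adj    : Fin n → Fin n → Bool
    sym    : ∀ x y → adj x y ≡ adj y x
    irrefl : ∀ x → adj x x ≡ false

countF : ∀ {n} → (Fin n → Bool) → ℕ
countF {zero}  f = 0
countF {suc n} f = (if f fzero then 1 else 0) + countF (λ i → f (fsuc i))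

sumF : ∀ {n} → (Fin n → ℕ) → ℕ
sumF {zero}  f = 0
sumF {suc n} f = f fzero + sumF (λ i → f (fsuc i))

anyF : ∀ {n} → (Fin n → Bool) → Bool
anyF {zero}  f = false
anyF {suc n} f = f fzero ∨ anyF (λ i → f (fsuc i))

allF : ∀ {n} → (Fin n → Bool) → Bool
allF {zero}  f = true
allF {suc n} f = f fzero ∧ allF (λ i → f (fsuc i))

eqF : ∀ {n} → Fin n → Fin n → Bool
eqF x y = ⌊ x ≟ y ⌋

b2n : Bool → ℕ
b2n true  = 1
b2n false = 0

module _ (G : Graph) where
  open Graph G

  C4Free : Set
  C4Free = ∀ (a b c d : Fin n) → ¬ (a ≡ c) → ¬ (b ≡ d) →
           adj a b ≡ true → adj b c ≡ true → adj c d ≡ true → adj d a ≡ true →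
           adj a c ≡ false → adj b d ≡ false → ⊥

  inducedPath3 : Fin n → Fin n → Fin n → Bool
  inducedPath3 p q r = not (eqF p q) ∧ not (eqF q r) ∧ not (eqF p r)
                       ∧ adj p q ∧ adj q r ∧ not (adj p r)

  -- e' = {c,d} ∈ F_e for e = {a,b}: V(e) ∪ V(e') induces a path on 3 vertices
  inF : Fin n → Fin n → Fin n → Fin n → Bool
  inF a b c d =
    anyF λ p → anyF λ q → anyF λ r →
      inducedPath3 p q r ∧
      allF (λ z → ⌊ Data.Bool._≟_ (eqF z a ∨ eqF z b ∨ eqF z c ∨ eqF z d)
                                   (eqF z p ∨ eqF z q ∨ eqF z r) ⌋)
    where import Data.Bool

  -- |F_e| for e = {a,b}: number of edges {c,d} of G (each counted once,
  -- via toℕ c < toℕ d) such that {a,b} ∪ {c,d} induces a path on 3 vertices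
  sizeF : Fin n → Fin n → ℕ
  sizeF a b = sumF λ c → countF λ d → (toℕ c <ᵇ toℕ d) ∧ adj c d ∧ inF a b c d

  InducedP3 : Fin n → Fin n → Fin n → Set
  InducedP3 u v w = inducedPath3 u v w ≡ true

  module Layers (u v w : Fin n) where

    inA : Fin n → Bool
    inA x = eqF x u ∨ eqF x v ∨ eqF x w

    nA : Fin n → ℕ
    nA x = b2n (adj x u) + b2n (adj x v) + b2n (adj x w)

    inB : Fin n → Bool
    inB x = not (inA x) ∧ ((nA x ≡ᵇ 1) ∨ (nA x ≡ᵇ 2))

    inC : Fin n → Bool
    inC x = nA x ≡ᵇ 3

    inD : Fin n → Bool
    inD x = not (inA x ∨ inB x ∨ inC x) ∧ anyF (λ y → adj x y ∧ inC y)

    within : ℕ → Fin n → Bool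
    within zero    x = inB x
    within (suc k) x = within k x ∨ anyF (λ y → adj x y ∧ within k y)

    -- Bl i = B_i  (Bl 0 = B)
    Bl : ℕ → Fin n → Bool
    Bl zero    x = inB x
    Bl (suc k) x = not (inA x ∨ inB x ∨ inC x ∨ inD x)
                   ∧ within (suc k) x ∧ not (within k x)

    inE : ℕ → Fin n → Fin n → Bool
    inE i a b = adj a b ∧ ((Bl i a ∧ Bl (suc i) b) ∨ (Bl i b ∧ Bl (suc i) a))

    -- "i ≤ j" where j = min index i ≥ 0 with an edge e ∈ E_i, |F_e| ≥ 3 (j = ∞ allowed):
    -- no edge e ∈ E_i' with |F_e| ≥ 3 for any i' < i
    jAtLeast : ℕ → Set
    jAtLeast k = ∀ i → i < k → ∀ a b → inE i a b ≡ true → sizeF a b < 3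

    nSame : ℕ → Fin n → ℕ
    nSame i x = countF λ y → adj x y ∧ Bl i y

    nNext : ℕ → Fin n → ℕ
    nNext i x = countF λ y → adj x y ∧ Bl (suc i) y

-- For an edge ab, F_ab contains {a,c} for every neighbour c of a outside N[b] and {b,d} for
-- every neighbour d of b outside N[a].  A vertex x ∈ B_i (i ≥ 2) has a neighbour p ∈ B_{i-1},
-- p has a neighbour q ∈ B_{i-2}, and q has a neighbour r ∉ N[p] (in B_{i-3}, or in A when
-- i = 2).  Since j ≥ i, both |F_qp| and |F_px| are at most 2.  F_qp contains qr and px, so no
-- y ∈ N_same(x) is adjacent to p (py would be a third edge); hence every neighbour of x in
-- B_i ∪ B_{i+1} lies outside N[p], and as F_px contains pq, x has at most one such neighbour.
-- That a neighbour of x ∈ B_{k+1} at distance k from B lies in B_k uses |F_e| ≤ 3: it cannot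
-- lie in D, for a D-vertex y adjacent to x with a neighbour c ∈ C gives cu, cv, cw, yx ∈ F_cy.

module Submission where

open import Defs
open import Data.Nat using (ℕ; _≤_; _<_)
open import Data.Fin using (Fin)
open import Data.Bool using (true)
open import Relation.Binary.PropositionalEquality using (_≡_)
open import Data.Product using (_×_)

import Algebra.Solver.IdempotentCommutativeMonoid as ICM-Solver
open import Data.Bool using (Bool; false; _∧_; _∨_; not; if_then_else_; T)
open import Data.Bool.Properties
  using (∨-zeroʳ; ∧-identityʳ; ∧-conicalˡ; ∧-conicalʳ; ∨-conicalˡ; ∨-conicalʳ; ¬-not; T-≡;
         ∨-idempotentCommutativeMonoid)
  renaming (_≟_ to _≟ᵇ_)
open import Data.Empty using (⊥-elim)
open import Data.Fin using (toℕ) renaming (zero to fzero; suc to fsuc)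
open import Data.Fin.Properties using (_≟_; toℕ-injective; suc-injective; 0≢1+n)
open import Data.List using (List; []; _∷_; length; map; _++_)
open import Data.List.Properties using (length-++; length-map)
open import Data.List.Relation.Unary.All as All using (All; []; _∷_)
import Data.List.Relation.Unary.All.Properties as All
open import Data.List.Relation.Unary.AllPairs as AllPairs using (AllPairs; []; _∷_)
import Data.List.Relation.Unary.AllPairs.Properties as AllPairs
open import Data.Nat using (zero; suc; _+_; _<ᵇ_; _≡ᵇ_; z≤n; s≤s; _≤′_; ≤′-refl; ≤′-step)
open import Data.Nat.Properties using (<-cmp; <⇒<ᵇ; <⇒≱; ≤⇒≯; ≤-refl; ≤⇒≤′; n≤1+n; +-suc)
open import Data.Product using (∃-syntax; _,_; proj₁; proj₂; map₂; uncurry; swap)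
open import Data.Product.Properties using (×-≡,≡←≡)
open import Data.Sum using (_⊎_; inj₁; inj₂)
open import Data.Vec using ([]; _∷_)
open import Function using (_∘_; _on_; Equivalence)
open import Relation.Binary using (tri<; tri≈; tri>)
open import Relation.Binary.PropositionalEquality
  using (_≢_; ≢-sym; refl; sym; trans; cong; cong₂; subst; module ≡-Reasoning)
open import Relation.Nullary using (Dec; yes; no; ¬_)
open import Relation.Nullary.Decidable using (⌊_⌋; dec-true; dec-false; isYes≗does; ⌊⌋-map′)

∨-true : ∀ {x y} → x ∨ y ≡ true → x ≡ true ⊎ y ≡ true
∨-true {true}  _   = inj₁ refl
∨-true {false} y≡t = inj₂ y≡t

∧-split : ∀ x {y} → x ∧ y ≡ true → x ≡ true × y ≡ true
∧-split true y≡t = refl , y≡t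

∨-resolveʳ : ∀ {x y} → x ≡ false → x ∨ y ≡ true → y ≡ true
∨-resolveʳ refl x∨y = x∨y

not-true : ∀ {x} → not x ≡ true → x ≡ false
not-true {false} _ = refl

true≢false : ∀ {x} → x ≡ true → x ≢ false
true≢false refl ()

⌊⌋-true : ∀ {a} {A : Set a} (a? : Dec A) → A → ⌊ a? ⌋ ≡ true
⌊⌋-true a? a = trans (isYes≗does a?) (dec-true a? a)

⌊⌋-false : ∀ {a} {A : Set a} (a? : Dec A) → ¬ A → ⌊ a? ⌋ ≡ false
⌊⌋-false a? ¬a = trans (isYes≗does a?) (dec-false a? ¬a)

eqF-sound : ∀ {n} {x y : Fin n} → eqF x y ≡ true → x ≡ y
eqF-sound {x = x} {y} e with x ≟ y
... | yes x≡y = x≡y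

anyF-intro : ∀ {n} (f : Fin n → Bool) p → f p ≡ true → anyF f ≡ true
anyF-intro f fzero    fp = cong (_∨ anyF (f ∘ fsuc)) fp
anyF-intro f (fsuc p) fp = trans (cong (f fzero ∨_) (anyF-intro (f ∘ fsuc) p fp)) (∨-zeroʳ (f fzero))

anyF-witness : ∀ {n} (f : Fin n → Bool) → anyF f ≡ true → ∃[ p ] f p ≡ true
anyF-witness {suc n} f e with ∨-true e
... | inj₁ f0 = fzero , f0
... | inj₂ fs = let p , fp = anyF-witness (f ∘ fsuc) fs in fsuc p , fp

allF-intro : ∀ {n} (f : Fin n → Bool) → (∀ z → f z ≡ true) → allF f ≡ true
allF-intro {zero}  f h = refl
allF-intro {suc n} f h = cong₂ _∧_ (h fzero) (allF-intro (f ∘ fsuc) (h ∘ fsuc))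

indicator : Bool → ℕ
indicator b = if b then 1 else 0

countF-cong : ∀ {n} {f g : Fin n → Bool} → (∀ x → f x ≡ g x) → countF f ≡ countF g
countF-cong {zero}  h = refl
countF-cong {suc n} h = cong₂ _+_ (cong indicator (h fzero)) (countF-cong (h ∘ fsuc))

countF≡0 : ∀ {n} (f : Fin n → Bool) → (∀ x → f x ≡ false) → countF f ≡ 0
countF≡0 {zero}  f h = refl
countF≡0 {suc n} f h rewrite h fzero = countF≡0 (f ∘ fsuc) (h ∘ fsuc)

countF≤1 : ∀ {n} (f : Fin n → Bool) → (∀ x y → f x ≡ true → f y ≡ true → x ≡ y) → countF f ≤ 1
countF≤1 {zero}  f h = z≤n
countF≤1 {suc n} f h with f fzero in f0
... | false = countF≤1 (f ∘ fsuc) (λ x y fx fy → suc-injective (h (fsuc x) (fsuc y) fx fy))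
... | true  rewrite countF≡0 (f ∘ fsuc) (λ x → ¬-not (λ fx → 0≢1+n (h fzero (fsuc x) f0 fx))) = s≤s z≤n

countF-witness : ∀ {n k} (f : Fin n → Bool) → countF f ≡ suc k → ∃[ p ] f p ≡ true
countF-witness {suc n} f e with f fzero in f0
... | true  = fzero , f0
... | false = let p , fp = countF-witness (f ∘ fsuc) e in fsuc p , fp

eqF-suc : ∀ {n} (x y : Fin n) → eqF (fsuc x) (fsuc y) ≡ eqF x y
eqF-suc x y = ⌊⌋-map′ _ _ (x ≟ y)

countF-remove : ∀ {n} (f : Fin n → Bool) p → f p ≡ true →
                countF f ≡ suc (countF (λ x → f x ∧ not (eqF x p)))
countF-remove f fzero fp rewrite fp =
  cong suc (countF-cong (λ x → sym (∧-identityʳ (f (fsuc x)))))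
countF-remove f (fsuc p) fp = begin
  indicator (f fzero) + countF (f ∘ fsuc)
    ≡⟨ cong₂ _+_ (cong indicator (sym (∧-identityʳ (f fzero)))) (countF-remove (f ∘ fsuc) p fp) ⟩
  indicator (f fzero ∧ true) + suc (countF (λ x → f (fsuc x) ∧ not (eqF x p)))
    ≡⟨ +-suc _ _ ⟩
  suc (indicator (f fzero ∧ true) + countF (λ x → f (fsuc x) ∧ not (eqF x p)))
    ≡⟨ cong (λ c → suc (indicator (f fzero ∧ true) + c))
            (countF-cong (λ x → cong (λ b → f (fsuc x) ∧ not b) (sym (eqF-suc x p)))) ⟩
  suc (countF (λ x → f x ∧ not (eqF x (fsuc p)))) ∎
  where open ≡-Reasoning

sumF-cong : ∀ {n} {g h : Fin n → ℕ} → (∀ x → g x ≡ h x) → sumF g ≡ sumF h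
sumF-cong {zero}  e = refl
sumF-cong {suc n} e = cong₂ _+_ (e fzero) (sumF-cong (e ∘ fsuc))

sumF-point : ∀ {n} (g h : Fin n → ℕ) p → g p ≡ suc (h p) → (∀ c → c ≢ p → g c ≡ h c) →
             sumF g ≡ suc (sumF h)
sumF-point g h fzero    gp elsewhere =
  cong₂ _+_ gp (sumF-cong (λ c → elsewhere (fsuc c) λ ()))
sumF-point g h (fsuc p) gp elsewhere = begin
  g fzero + sumF (g ∘ fsuc)        ≡⟨ cong₂ _+_ (elsewhere fzero λ ()) tail ⟩
  h fzero + suc (sumF (h ∘ fsuc))  ≡⟨ +-suc _ _ ⟩
  suc (sumF h)                     ∎
  where
  open ≡-Reasoning
  tail : sumF (g ∘ fsuc) ≡ suc (sumF (h ∘ fsuc))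
  tail = sumF-point (g ∘ fsuc) (h ∘ fsuc) p gp (λ c c≢p → elsewhere (fsuc c) (c≢p ∘ suc-injective))

pairCount : ∀ {n} → (Fin n → Fin n → Bool) → ℕ
pairCount f = sumF λ c → countF (f c)

removePair : ∀ {n} → (Fin n → Fin n → Bool) → Fin n × Fin n → Fin n → Fin n → Bool
removePair f (c₀ , d₀) c d = f c d ∧ not (eqF c c₀ ∧ eqF d d₀)

pairCount-remove : ∀ {n} (f : Fin n → Fin n → Bool) c₀ d₀ → f c₀ d₀ ≡ true →
                   pairCount f ≡ suc (pairCount (removePair f (c₀ , d₀)))
pairCount-remove f c₀ d₀ fcd = sumF-point _ _ c₀ row-c₀ other-rows
  where
  row-c₀ : countF (f c₀) ≡ suc (countF (removePair f (c₀ , d₀) c₀))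
  row-c₀ rewrite ⌊⌋-true (c₀ ≟ c₀) refl = countF-remove (f c₀) d₀ fcd
  other-rows : ∀ c → c ≢ c₀ → countF (f c) ≡ countF (removePair f (c₀ , d₀) c)
  other-rows c c≢c₀ rewrite ⌊⌋-false (c ≟ c₀) c≢c₀ = countF-cong (λ d → sym (∧-identityʳ (f c d)))

removePair-keeps : ∀ {n} (f : Fin n → Fin n → Bool) {p c d} → p ≢ (c , d) → f c d ≡ true →
                   removePair f p c d ≡ true
removePair-keeps f p≢cd fcd = cong₂ _∧_ fcd (cong not (¬-not λ same →
  p≢cd (sym (cong₂ _,_ (eqF-sound (∧-conicalˡ _ _ same)) (eqF-sound (∧-conicalʳ _ _ same))))))

distinct≤pairCount : ∀ {n} (f : Fin n → Fin n → Bool) (ps : List (Fin n × Fin n)) →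
                     AllPairs _≢_ ps → All (λ p → uncurry f p ≡ true) ps → length ps ≤ pairCount f
distinct≤pairCount f []             []         []         = z≤n
distinct≤pairCount f ((c , d) ∷ ps) (p∉ps ∷ u) (fcd ∷ fps)
  rewrite pairCount-remove f c d fcd =
  s≤s (distinct≤pairCount _ ps u (All.zipWith (uncurry (removePair-keeps f)) (p∉ps , fps)))

sortPair : ∀ {n} → Fin n → Fin n → Fin n × Fin n
sortPair s t = if toℕ s <ᵇ toℕ t then (s , t) else (t , s)

sortPair-cases : ∀ {n} (s t : Fin n) → sortPair s t ≡ (s , t) ⊎ sortPair s t ≡ (t , s)
sortPair-cases s t with toℕ s <ᵇ toℕ t
... | true  = inj₁ refl
... | false = inj₂ refl

sortPair-injective : ∀ {n} {s t s′ t′ : Fin n} → sortPair s t ≡ sortPair s′ t′ →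
                     (s ≡ s′ × t ≡ t′) ⊎ (s ≡ t′ × t ≡ s′)
sortPair-injective {s = s} {t} {s′} {t′} eq with sortPair-cases s t | sortPair-cases s′ t′
... | inj₁ e | inj₁ e′ = inj₁ (×-≡,≡←≡ (trans (sym e) (trans eq e′)))
... | inj₁ e | inj₂ e′ = inj₂ (×-≡,≡←≡ (trans (sym e) (trans eq e′)))
... | inj₂ e | inj₁ e′ = inj₂ (swap (×-≡,≡←≡ (trans (sym e) (trans eq e′))))
... | inj₂ e | inj₂ e′ = inj₁ (swap (×-≡,≡←≡ (trans (sym e) (trans eq e′))))

sortPair-sorted : ∀ {n} (g : Fin n → Fin n → Bool) {s t} → s ≢ t → g s t ≡ true → g t s ≡ true →
                  uncurry (λ c d → (toℕ c <ᵇ toℕ d) ∧ g c d) (sortPair s t) ≡ true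
sortPair-sorted g {s} {t} s≢t gst gts with toℕ s <ᵇ toℕ t in s<ᵇt
... | true  = cong₂ _∧_ s<ᵇt gst
... | false = cong₂ _∧_ t<ᵇs gts
  where
  t<ᵇs : (toℕ t <ᵇ toℕ s) ≡ true
  t<ᵇs with <-cmp (toℕ s) (toℕ t)
  ... | tri< s<t _ _ = ⊥-elim (subst T s<ᵇt (<⇒<ᵇ s<t))
  ... | tri≈ _ s≡t _ = ⊥-elim (s≢t (toℕ-injective s≡t))
  ... | tri> _ _ t<s = Equivalence.to T-≡ (<⇒<ᵇ t<s)

b2n-sum∉123 : ∀ α β γ → ((b2n α + b2n β + b2n γ ≡ᵇ 1) ∨ (b2n α + b2n β + b2n γ ≡ᵇ 2)) ≡ false →
              (b2n α + b2n β + b2n γ ≡ᵇ 3) ≡ false → α ≡ false × β ≡ false × γ ≡ false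
b2n-sum∉123 false false false _  _  = refl , refl , refl
b2n-sum∉123 false false true  () _
b2n-sum∉123 false true  false () _
b2n-sum∉123 true  false false () _
b2n-sum∉123 false true  true  () _
b2n-sum∉123 true  false true  () _
b2n-sum∉123 true  true  false () _
b2n-sum∉123 true  true  true  _  ()

b2n-sum≡3 : ∀ α β γ → (b2n α + b2n β + b2n γ ≡ᵇ 3) ≡ true → α ≡ true × β ≡ true × γ ≡ true
b2n-sum≡3 true  true  true  _ = refl , refl , refl
b2n-sum≡3 false false false ()
b2n-sum≡3 false false true  ()
b2n-sum≡3 false true  false ()
b2n-sum≡3 true  false false ()
b2n-sum≡3 false true  true  ()
b2n-sum≡3 true  false true  ()
b2n-sum≡3 true  true  false ()

b2n-sum∈12 : ∀ α β γ → ((b2n α + b2n β + b2n γ ≡ᵇ 1) ∨ (b2n α + b2n β + b2n γ ≡ᵇ 2)) ≡ true →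
             α ≡ true ⊎ β ≡ true ⊎ γ ≡ true
b2n-sum∈12 true  _     _     _ = inj₁ refl
b2n-sum∈12 false true  _     _ = inj₂ (inj₁ refl)
b2n-sum∈12 false false true  _ = inj₂ (inj₂ refl)
b2n-sum∈12 false false false ()

eqF-false⇒≢ : ∀ {n} {x y : Fin n} → eqF x y ≡ false → x ≢ y
eqF-false⇒≢ {x = x} {y} e x≡y = true≢false (⌊⌋-true (x ≟ y) x≡y) e

module _ (G : Graph) where
  open Graph G using (n; adj; irrefl) renaming (sym to adj-comm)

  adj-flip : ∀ {a b β} → adj a b ≡ β → adj b a ≡ β
  adj-flip {a} {b} = trans (adj-comm b a)

  adj⇒≢ : ∀ {a b} → adj a b ≡ true → a ≢ b
  adj⇒≢ {a} ab refl = true≢false ab (irrefl a)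

  inducedPath3-intro : ∀ {p q r} → p ≢ q → q ≢ r → p ≢ r →
                       adj p q ≡ true → adj q r ≡ true → adj p r ≡ false → inducedPath3 G p q r ≡ true
  inducedPath3-intro {p} {q} {r} p≢q q≢r p≢r pq qr pr
    rewrite ⌊⌋-false (p ≟ q) p≢q | ⌊⌋-false (q ≟ r) q≢r | ⌊⌋-false (p ≟ r) p≢r | pq | qr | pr = refl

  inducedPath3-distinct : ∀ {p q r} → inducedPath3 G p q r ≡ true → p ≢ q × q ≢ r × p ≢ r
  inducedPath3-distinct {p} {q} {r} pqr =
    let p≢q , rest = ∧-split (not (eqF p q)) pqr
        q≢r , rest′ = ∧-split (not (eqF q r)) rest
        p≢r , _ = ∧-split (not (eqF p r)) rest′
    in eqF-false⇒≢ (not-true p≢q) , eqF-false⇒≢ (not-true q≢r) , eqF-false⇒≢ (not-true p≢r)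

  inF-intro : ∀ {a b c d p q r} → inducedPath3 G p q r ≡ true →
              (∀ z → (eqF z a ∨ eqF z b ∨ eqF z c ∨ eqF z d) ≡ (eqF z p ∨ eqF z q ∨ eqF z r)) →
              inF G a b c d ≡ true
  inF-intro {p = p} {q} {r} pqr sameVertices =
    anyF-intro _ p (anyF-intro _ q (anyF-intro _ r (cong₂ _∧_ pqr
      (allF-intro _ λ z → ⌊⌋-true (_ ≟ᵇ _) (sameVertices z)))))

  record PrivateNeighbour (a b : Fin n) : Set where
    constructor privateNeighbour
    field
      vertex      : Fin n
      adjacent    : adj a vertex ≡ true
      nonadjacent : adj b vertex ≡ false
      distinct    : b ≢ vertex
  open PrivateNeighbour

  InF : Fin n → Fin n → Fin n × Fin n → Bool
  InF a b = uncurry λ c d → (toℕ c <ᵇ toℕ d) ∧ adj c d ∧ inF G a b c d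

  private
    module ∨-Solver = ICM-Solver ∨-idempotentCommutativeMonoid
    open ∨-Solver using (Expr; prove; var) renaming (_⊕_ to _∨′_)

    α β γ : Expr 3
    α = var fzero
    β = var (fsuc fzero)
    γ = var (fsuc (fsuc fzero))

  InF-sortPairˡ : ∀ {a b} → adj a b ≡ true → (c : PrivateNeighbour a b) →
                  InF a b (sortPair a (vertex c)) ≡ true
  InF-sortPairˡ {a} {b} ab (privateNeighbour c ac bc b≢c) =
    sortPair-sorted (λ s t → adj s t ∧ inF G a b s t) (adj⇒≢ ac)
      (cong₂ _∧_ ac (inF-intro path λ z →
        prove 3 (α ∨′ β ∨′ α ∨′ γ) (β ∨′ α ∨′ γ) (eqF z a ∷ eqF z b ∷ eqF z c ∷ [])))
      (cong₂ _∧_ (adj-flip ac) (inF-intro path λ z →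
        prove 3 (α ∨′ β ∨′ γ ∨′ α) (β ∨′ α ∨′ γ) (eqF z a ∷ eqF z b ∷ eqF z c ∷ [])))
    where
    path : inducedPath3 G b a c ≡ true
    path = inducedPath3-intro (adj⇒≢ (adj-flip ab)) (adj⇒≢ ac) b≢c (adj-flip ab) ac bc

  InF-sortPairʳ : ∀ {a b} → adj a b ≡ true → (d : PrivateNeighbour b a) →
                  InF a b (sortPair b (vertex d)) ≡ true
  InF-sortPairʳ {a} {b} ab (privateNeighbour d bd ad a≢d) =
    sortPair-sorted (λ s t → adj s t ∧ inF G a b s t) (adj⇒≢ bd)
      (cong₂ _∧_ bd (inF-intro path λ z →
        prove 3 (α ∨′ β ∨′ β ∨′ γ) (α ∨′ β ∨′ γ) (eqF z a ∷ eqF z b ∷ eqF z d ∷ [])))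
      (cong₂ _∧_ (adj-flip bd) (inF-intro path λ z →
        prove 3 (α ∨′ β ∨′ γ ∨′ β) (α ∨′ β ∨′ γ) (eqF z a ∷ eqF z b ∷ eqF z d ∷ [])))
    where
    path : inducedPath3 G a b d ≡ true
    path = inducedPath3-intro (adj⇒≢ ab) (adj⇒≢ bd) a≢d ab bd ad

  sortPair-vertex-injective : ∀ {a b} (c c′ : PrivateNeighbour a b) →
                              sortPair a (vertex c) ≡ sortPair a (vertex c′) → vertex c ≡ vertex c′
  sortPair-vertex-injective c c′ eq with sortPair-injective eq
  ... | inj₁ (_ , c≡c′)  = c≡c′
  ... | inj₂ (a≡c′ , _) = ⊥-elim (adj⇒≢ (adjacent c′) a≡c′)

  sortPair-vertex-≢ : ∀ {a b} → adj a b ≡ true → (c : PrivateNeighbour a b) (d : PrivateNeighbour b a) →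
                      sortPair a (vertex c) ≢ sortPair b (vertex d)
  sortPair-vertex-≢ ab c d eq with sortPair-injective eq
  ... | inj₁ (a≡b , _) = adj⇒≢ ab a≡b
  ... | inj₂ (_ , c≡b) = distinct c (sym c≡b)

  private-neighbours≤sizeF : ∀ {a b} → adj a b ≡ true →
                             (cs : List (PrivateNeighbour a b)) (ds : List (PrivateNeighbour b a)) →
                             AllPairs (_≢_ on vertex) cs → AllPairs (_≢_ on vertex) ds →
                             length cs + length ds ≤ sizeF G a b
  private-neighbours≤sizeF {a} {b} ab cs ds cs-distinct ds-distinct =
    subst (_≤ sizeF G a b) length-keys (distinct≤pairCount _ keys keys-distinct keys-InF)
    where
    keys : List (Fin n × Fin n)
    keys = map (sortPair a ∘ vertex) cs ++ map (sortPair b ∘ vertex) ds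

    length-keys : length keys ≡ length cs + length ds
    length-keys = trans (length-++ (map _ cs)) (cong₂ _+_ (length-map _ cs) (length-map _ ds))

    keys-InF : All (λ p → InF a b p ≡ true) keys
    keys-InF = All.++⁺ (All.map⁺ (All.universal (InF-sortPairˡ ab) cs))
                       (All.map⁺ (All.universal (InF-sortPairʳ ab) ds))

    keys-distinct : AllPairs _≢_ keys
    keys-distinct = AllPairs.++⁺
      (AllPairs.map⁺ (AllPairs.map (λ {c} {c′} → _∘ sortPair-vertex-injective c c′) cs-distinct))
      (AllPairs.map⁺ (AllPairs.map (λ {d} {d′} → _∘ sortPair-vertex-injective d d′) ds-distinct))
      (All.map⁺ (All.universal (λ c → All.map⁺ (All.universal (sortPair-vertex-≢ ab c) ds)) cs))

module _ (G : Graph) (u v w : Fin (Graph.n G)) where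
  open Graph G using (n; adj)
  open Layers G u v w
  open PrivateNeighbour

  within-step : ∀ k {x y} → adj x y ≡ true → within k y ≡ true → within (suc k) x ≡ true
  within-step k {x} {y} xy wy =
    trans (cong (within k x ∨_) (anyF-intro _ y (cong₂ _∧_ xy wy))) (∨-zeroʳ (within k x))

  within-mono : ∀ {k m x} → k ≤ m → within k x ≡ true → within m x ≡ true
  within-mono {k} {x = x} k≤m wx = go (≤⇒≤′ k≤m)
    where
    go : ∀ {m} → k ≤′ m → within m x ≡ true
    go ≤′-refl                   = wx
    go {suc m} (≤′-step k≤′m) = cong (_∨ anyF λ y → adj x y ∧ within m y) (go k≤′m)

  Bl-suc-parts : ∀ k x → Bl (suc k) x ≡ true →
                 (inA x ∨ inB x ∨ inC x ∨ inD x) ≡ false × within (suc k) x ≡ true × within k x ≡ false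
  Bl-suc-parts k x x∈B =
    let x∉ABCD , rest = ∧-split (not (inA x ∨ inB x ∨ inC x ∨ inD x)) x∈B
        wₖ₊₁ , ¬wₖ = ∧-split (within (suc k) x) rest
    in not-true x∉ABCD , wₖ₊₁ , not-true ¬wₖ

  Bl⇒within : ∀ k {x} → Bl k x ≡ true → within k x ≡ true
  Bl⇒within zero        x∈B = x∈B
  Bl⇒within (suc k) {x} x∈B = proj₁ (proj₂ (Bl-suc-parts k x x∈B))

  Bl-suc⇒¬within : ∀ k {x} → Bl (suc k) x ≡ true → within k x ≡ false
  Bl-suc⇒¬within k {x} x∈B = proj₂ (proj₂ (Bl-suc-parts k x x∈B))

  Bl-≢ : ∀ {m m′ y z} → m ≤ m′ → Bl m y ≡ true → Bl (suc m′) z ≡ true → y ≢ z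
  Bl-≢ {m} {m′} m≤m′ y∈B z∈B refl =
    true≢false (within-mono m≤m′ (Bl⇒within m y∈B)) (Bl-suc⇒¬within m′ z∈B)

  Bl-¬adj : ∀ {m m′ y z} → suc m ≤ m′ → Bl m y ≡ true → Bl (suc m′) z ≡ true → adj z y ≡ false
  Bl-¬adj {m} {m′} m<m′ y∈B z∈B = ¬-not λ zy →
    true≢false (within-mono m<m′ (within-step m zy (Bl⇒within m y∈B))) (Bl-suc⇒¬within m′ z∈B)

  inE-intro : ∀ i {a b} → adj a b ≡ true → Bl i a ≡ true → Bl (suc i) b ≡ true → inE i a b ≡ true
  inE-intro i {a} {b} ab a∈B b∈B =
    cong₂ _∧_ ab (cong (_∨ (Bl i b ∧ Bl (suc i) a)) (cong₂ _∧_ a∈B b∈B))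

  Forward : ℕ → Fin n → Fin n → Set
  Forward k x y = adj x y ≡ true × (Bl (2 + k) y ≡ true ⊎ Bl (3 + k) y ≡ true)

  record Outside (x : Fin n) : Set where
    field
      ∉A : inA x ≡ false
      ∉B : inB x ≡ false
      ∉C : inC x ≡ false
      ∉D : inD x ≡ false
  open Outside

  Bl-suc⇒Outside : ∀ k {x} → Bl (suc k) x ≡ true → Outside x
  Bl-suc⇒Outside k {x} x∈B = record
    { ∉A = ∨-conicalˡ _ _ x∉ABCD
    ; ∉B = ∨-conicalˡ _ _ (∨-conicalʳ (inA x) _ x∉ABCD)
    ; ∉C = ∨-conicalˡ _ _ (∨-conicalʳ (inB x) _ (∨-conicalʳ (inA x) _ x∉ABCD))
    ; ∉D = ∨-conicalʳ (inC x) _ (∨-conicalʳ (inB x) _ (∨-conicalʳ (inA x) _ x∉ABCD))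
    }
    where x∉ABCD = proj₁ (Bl-suc-parts k x x∈B)

  u∈A : inA u ≡ true
  u∈A = cong (_∨ (eqF u v ∨ eqF u w)) (⌊⌋-true (u ≟ u) refl)

  v∈A : inA v ≡ true
  v∈A = trans (cong (λ b → eqF v u ∨ b ∨ eqF v w) (⌊⌋-true (v ≟ v) refl)) (∨-zeroʳ (eqF v u))

  w∈A : inA w ≡ true
  w∈A = trans (cong (λ b → eqF w u ∨ eqF w v ∨ b) (⌊⌋-true (w ≟ w) refl))
              (trans (cong (eqF w u ∨_) (∨-zeroʳ (eqF w v))) (∨-zeroʳ (eqF w u)))

  A-elim : ∀ (P : Fin n → Set) → P u × P v × P w → ∀ {a} → inA a ≡ true → P a
  A-elim P (pu , pv , pw) {a} a∈A with ∨-true {eqF a u} a∈A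
  ... | inj₁ a≡u = subst P (sym (eqF-sound a≡u)) pu
  ... | inj₂ a∈vw with ∨-true {eqF a v} a∈vw
  ...   | inj₁ a≡v = subst P (sym (eqF-sound a≡v)) pv
  ...   | inj₂ a≡w = subst P (sym (eqF-sound a≡w)) pw

  ∉A⇒≢ : ∀ {y a} → inA y ≡ false → inA a ≡ true → y ≢ a
  ∉A⇒≢ y∉A a∈A refl = true≢false a∈A y∉A

  ∉ABC⇒¬adjA : ∀ {x a} → inA x ≡ false → inB x ≡ false → inC x ≡ false →
               inA a ≡ true → adj x a ≡ false
  ∉ABC⇒¬adjA {x} x∉A x∉B x∉C =
    A-elim (λ a → adj x a ≡ false) (b2n-sum∉123 (adj x u) (adj x v) (adj x w) x∉B′ x∉C)
    where
    x∉B′ : ((nA x ≡ᵇ 1) ∨ (nA x ≡ᵇ 2)) ≡ false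
    x∉B′ = subst (λ ι → not ι ∧ ((nA x ≡ᵇ 1) ∨ (nA x ≡ᵇ 2)) ≡ false) x∉A x∉B

  C⇒adjA : ∀ {c a} → inC c ≡ true → inA a ≡ true → adj c a ≡ true
  C⇒adjA {c} c∈C = A-elim (λ a → adj c a ≡ true) (b2n-sum≡3 (adj c u) (adj c v) (adj c w) c∈C)

  B⇒adjA : ∀ {q} → inB q ≡ true → ∃[ a ] inA a ≡ true × adj q a ≡ true
  B⇒adjA {q} q∈B with b2n-sum∈12 (adj q u) (adj q v) (adj q w) (proj₂ (∧-split (not (inA q)) q∈B))
  ... | inj₁ qu        = u , u∈A , qu
  ... | inj₂ (inj₁ qv) = v , v∈A , qv
  ... | inj₂ (inj₂ qw) = w , w∈A , qw

  Outside⇒¬adjA : ∀ {x a} → Outside x → inA a ≡ true → adj x a ≡ false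
  Outside⇒¬adjA xo = ∉ABC⇒¬adjA (∉A xo) (∉B xo) (∉C xo)

  Outside⇒¬adjC : ∀ {x c} → Outside x → inC c ≡ true → adj x c ≡ false
  Outside⇒¬adjC {x} {c} xo c∈C = ¬-not λ xc → true≢false
    (cong₂ _∧_ (cong not (cong₂ _∨_ (∉A xo) (cong₂ _∨_ (∉B xo) (∉C xo))))
               (anyF-intro (λ y → adj x y ∧ inC y) c (cong₂ _∧_ xc c∈C)))
    (∉D xo)

  module _ (uvw : InducedP3 G u v w) (bound : ∀ a b → adj a b ≡ true → sizeF G a b ≤ 3) where

    Outside-D-neighbour⇒|F|≥4 : ∀ {x y c} → Outside x → adj x y ≡ true → inD y ≡ true →
                                adj y c ≡ true → inC c ≡ true → 4 ≤ sizeF G c y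
    Outside-D-neighbour⇒|F|≥4 {x} {y} {c} xo xy y∈D yc c∈C with inducedPath3-distinct G {u} {v} {w} uvw
    ... | u≢v , v≢w , u≢w =
      private-neighbours≤sizeF G (adj-flip G yc) (viaA u u∈A ∷ viaA v v∈A ∷ viaA w w∈A ∷ []) (viaX ∷ [])
        ((u≢v ∷ u≢w ∷ []) ∷ (v≢w ∷ []) ∷ [] ∷ []) ([] ∷ [])
      where
      y∉ABC : (inA y ∨ inB y ∨ inC y) ≡ false
      y∉ABC = not-true (proj₁ (∧-split (not (inA y ∨ inB y ∨ inC y)) y∈D))
      y∉A : inA y ≡ false
      y∉A = ∨-conicalˡ _ _ y∉ABC
      y∉B : inB y ≡ false
      y∉B = ∨-conicalˡ _ _ (∨-conicalʳ (inA y) _ y∉ABC)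
      y∉C : inC y ≡ false
      y∉C = ∨-conicalʳ (inB y) _ (∨-conicalʳ (inA y) _ y∉ABC)

      viaA : ∀ a → inA a ≡ true → PrivateNeighbour G c y
      viaA a a∈A =
        privateNeighbour a (C⇒adjA c∈C a∈A) (∉ABC⇒¬adjA y∉A y∉B y∉C a∈A) (∉A⇒≢ y∉A a∈A)

      viaX : PrivateNeighbour G y c
      viaX = privateNeighbour x (adj-flip G xy) (adj-flip G (Outside⇒¬adjC xo c∈C))
                              λ { refl → true≢false c∈C (∉C xo) }

    Outside⇒¬adjD : ∀ {x y} → Outside x → adj x y ≡ true → inD y ≡ false
    Outside⇒¬adjD {x} {y} xo xy = ¬-not λ y∈D →
      let c , yc∧c∈C = anyF-witness _ (proj₂ (∧-split (not (inA y ∨ inB y ∨ inC y)) y∈D))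
          yc , c∈C = ∧-split (adj y c) yc∧c∈C
      in ≤⇒≯ (bound c y (adj-flip G yc)) (Outside-D-neighbour⇒|F|≥4 xo xy y∈D yc c∈C)

    within-neighbour⇒Bl : ∀ k {x p} → Bl (suc k) x ≡ true → adj x p ≡ true → within k p ≡ true →
                          Bl k p ≡ true
    within-neighbour⇒Bl zero    _   _  p∈B = p∈B
    within-neighbour⇒Bl (suc k) {x} {p} x∈B xp pw =
      cong₂ _∧_ (cong not p∉ABCD) (cong₂ _∧_ pw (cong not p∉within))
      where
      xo = Bl-suc⇒Outside (suc k) x∈B

      p∉within : within k p ≡ false
      p∉within = ¬-not λ w → true≢false (within-step k xp w) (Bl-suc⇒¬within (suc k) x∈B)

      p∉ABCD : (inA p ∨ inB p ∨ inC p ∨ inD p) ≡ false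
      p∉ABCD = cong₂ _∨_ p∉A (cong₂ _∨_ p∉B (cong₂ _∨_ p∉C (Outside⇒¬adjD xo xp)))
        where
        p∉A : inA p ≡ false
        p∉A = ¬-not λ p∈A → true≢false xp (Outside⇒¬adjA {a = p} xo p∈A)
        p∉B : inB p ≡ false
        p∉B = ¬-not λ p∈B → true≢false (within-mono {0} {k} {p} z≤n p∈B) p∉within
        p∉C : inC p ≡ false
        p∉C = ¬-not λ p∈C → true≢false xp (Outside⇒¬adjC {c = p} xo p∈C)

    Bl-suc⇒prev-neighbour : ∀ k {x} → Bl (suc k) x ≡ true → ∃[ p ] adj x p ≡ true × Bl k p ≡ true
    Bl-suc⇒prev-neighbour k {x} x∈B =
      let p , xp∧pw = anyF-witness (λ p → adj x p ∧ within k p)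
                        (∨-resolveʳ (Bl-suc⇒¬within k x∈B) (Bl⇒within (suc k) x∈B))
          xp , pw = ∧-split (adj x p) xp∧pw
      in p , xp , within-neighbour⇒Bl k x∈B xp pw

    back-private-neighbour : ∀ m {q p} → Bl m q ≡ true → Bl (suc m) p ≡ true → PrivateNeighbour G q p
    back-private-neighbour zero {q} {p} q∈B p∈B with B⇒adjA q∈B
    ... | a , a∈A , qa = privateNeighbour a qa (Outside⇒¬adjA po a∈A) (∉A⇒≢ (∉A po) a∈A)
      where po = Bl-suc⇒Outside 0 p∈B
    back-private-neighbour (suc m) q∈B p∈B with Bl-suc⇒prev-neighbour m q∈B
    ... | r , qr , r∈B =
      privateNeighbour r qr (Bl-¬adj {m} {suc m} ≤-refl r∈B p∈B) (≢-sym (Bl-≢ {m} {suc m} (n≤1+n m) r∈B p∈B))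

    same-layer-¬adj-prev : ∀ k {q p x y} → Bl k q ≡ true → Bl (1 + k) p ≡ true →
                           Bl (2 + k) x ≡ true → Bl (2 + k) y ≡ true →
                           adj q p ≡ true → adj p x ≡ true → adj x y ≡ true →
                           sizeF G q p < 3 → adj p y ≡ false
    same-layer-¬adj-prev k {q} {p} {x} {y} q∈B p∈B x∈B y∈B qp px xy |Fqp|<3 = ¬-not λ py →
      <⇒≱ |Fqp|<3 (private-neighbours≤sizeF G qp (back-private-neighbour k q∈B p∈B ∷ [])
                     (aheadOf x x∈B px ∷ aheadOf y y∈B py ∷ [])
                     ([] ∷ []) ((adj⇒≢ G xy ∷ []) ∷ [] ∷ []))
      where
      aheadOf : ∀ z → Bl (2 + k) z ≡ true → adj p z ≡ true → PrivateNeighbour G p q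
      aheadOf z z∈B pz = privateNeighbour z pz (adj-flip G (Bl-¬adj {k} {suc k} ≤-refl q∈B z∈B))
                                               (Bl-≢ {k} {suc k} (n≤1+n k) q∈B z∈B)

    forward-unique-on-path : ∀ k {q p x} → Bl k q ≡ true → Bl (1 + k) p ≡ true → Bl (2 + k) x ≡ true →
                             adj q p ≡ true → adj p x ≡ true → sizeF G q p < 3 → sizeF G p x < 3 →
                             ∀ {y t} → Forward k x y → Forward k x t → y ≡ t
    forward-unique-on-path k {q} {p} {x} q∈B p∈B x∈B qp px |Fqp|<3 |Fpx|<3 {y} {t} fy ft with y ≟ t
    ... | yes y≡t = y≡t
    ... | no  y≢t = ⊥-elim (<⇒≱ |Fpx|<3 (private-neighbours≤sizeF G px (q′ ∷ [])
                                           (ahead fy ∷ ahead ft ∷ []) ([] ∷ []) ((y≢t ∷ []) ∷ [] ∷ [])))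
      where
      q′ : PrivateNeighbour G p x
      q′ = privateNeighbour q (adj-flip G qp) (Bl-¬adj {k} {suc k} ≤-refl q∈B x∈B)
                              (≢-sym (Bl-≢ {k} {suc k} (n≤1+n k) q∈B x∈B))

      ahead : ∀ {z} → Forward k x z → PrivateNeighbour G x p
      ahead {z} (xz , z∈B) = privateNeighbour z xz (p≁z z∈B) (p≢z z∈B)
        where
        p≁z : Bl (2 + k) z ≡ true ⊎ Bl (3 + k) z ≡ true → adj p z ≡ false
        p≁z (inj₁ z∈B₂) = same-layer-¬adj-prev k q∈B p∈B x∈B z∈B₂ qp px xz |Fqp|<3
        p≁z (inj₂ z∈B₃) = adj-flip G (Bl-¬adj {suc k} {2 + k} ≤-refl p∈B z∈B₃)

        p≢z : Bl (2 + k) z ≡ true ⊎ Bl (3 + k) z ≡ true → p ≢ z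
        p≢z (inj₁ z∈B₂) = Bl-≢ {suc k} {suc k} ≤-refl p∈B z∈B₂
        p≢z (inj₂ z∈B₃) = Bl-≢ {suc k} {2 + k} (n≤1+n (suc k)) p∈B z∈B₃

    forward-neighbours-unique : ∀ k {x} → jAtLeast (2 + k) → Bl (2 + k) x ≡ true →
                                ∀ {y t} → Forward k x y → Forward k x t → y ≡ t
    forward-neighbours-unique k {x} j≥2+k x∈B =
      let p , xp , p∈B = Bl-suc⇒prev-neighbour (suc k) x∈B
          q , pq , q∈B = Bl-suc⇒prev-neighbour k p∈B
      in forward-unique-on-path k q∈B p∈B x∈B (adj-flip G pq) (adj-flip G xp)
           (j≥2+k k (n≤1+n (suc k)) q p (inE-intro k {q} {p} (adj-flip G pq) q∈B p∈B))
           (j≥2+k (suc k) ≤-refl p x (inE-intro (suc k) {p} {x} (adj-flip G xp) p∈B x∈B))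

lemma7 : (G : Graph) → C4Free G →
         (∀ a b → Graph.adj G a b ≡ true → sizeF G a b ≤ 3) →
         (u v w : Fin (Graph.n G)) → InducedP3 G u v w →
         Layers.jAtLeast G u v w 2 →
         ∀ (i : ℕ) → 2 ≤ i → Layers.jAtLeast G u v w i →
         ∀ (x : Fin (Graph.n G)) → Layers.Bl G u v w i x ≡ true →
         (Layers.nSame G u v w i x ≤ 1)
         × (Layers.nSame G u v w i x ≡ 1 → Layers.nNext G u v w i x ≡ 0)
lemma7 G _ bound u v w uvw _ (suc (suc k)) (s≤s (s≤s z≤n)) j≥i x x∈B =
  countF≤1 _ (λ y t y∈Nsame t∈Nsame → unique (same y∈Nsame) (same t∈Nsame)) , one-same⇒no-next
  where
  open Graph G using (adj)
  open Layers G u v w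

  unique : ∀ {y t} → Forward G u v w k x y → Forward G u v w k x t → y ≡ t
  unique = forward-neighbours-unique G u v w uvw bound k j≥i x∈B

  same : ∀ {y} → (adj x y ∧ Bl (2 + k) y) ≡ true → Forward G u v w k x y
  same {y} = map₂ inj₁ ∘ ∧-split (adj x y)

  next : ∀ {y} → (adj x y ∧ Bl (3 + k) y) ≡ true → Forward G u v w k x y
  next {y} = map₂ inj₂ ∘ ∧-split (adj x y)

  one-same⇒no-next : nSame (2 + k) x ≡ 1 → nNext (2 + k) x ≡ 0
  one-same⇒no-next one with countF-witness (λ y → adj x y ∧ Bl (2 + k) y) one
  ... | y , y∈Nsame = countF≡0 _ λ t → ¬-not λ t∈Nnext →
    Bl-≢ G u v w {2 + k} ≤-refl (proj₂ (∧-split (adj x y) y∈Nsame)) (proj₂ (∧-split (adj x t) t∈Nnext))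
      (unique (same y∈Nsame) (next t∈Nnext))
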